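{- Let $G_\psi$ be the instance constructed below from a formula $\psi$. Let $M$ be a Pareto-optimal matching in $G_\psi$. Then for every variable $r$ of $\psi$ and every positive clause $C_\ell$ containing $r$, the edges $(a_{r,\ell},b'_{r,\ell})$ and $(c_r,d'_r)$ are not both in $M$.
   Context: Matchings and preferences: node $u$ prefers matching $M$ to $N$ if $u$ is matched in $M$ and unmatched in $N$, or matched in both and prefers its partner in $M$; $\phi(M,N)$ is the number of nodes preferring $M$ to $N$. A matching $M$ is Pareto-optimal if there is no matching $N$ with $\phi(N,M)>0$ and $\phi(M,N)=0$. The formula: $\psi_0$ is a 3-CNF formula over $X_1,\ldots,X_n$, each clause having three literals on distinct variables. $\psi$ is obtained by replacing every occurrence of $\neg X_i$ by a new variable $X_{n+i}$ and adding clauses $(X_i\vee X_{n+i})$ and $(\neg X_i\vee\neg X_{n+i})$ for each $i\in[n]$. Clauses of $\psi$ containing only unnegated variables are positive (2 or 3 literals); the others are the negative clauses $(\neg X_i\vee\neg X_{n+i})$; each variable occurs negated exactly once. The graph $G_\psi$ (bipartite; nodes named $a,a',c,c'$ on one side, $b,b',d,d'$ on the other): for each positive clause $C_\ell$ and each variable $x$ in it, nodes $a_{x,\ell},a'_{x,\ell},b_{x,\ell},b'_{x,\ell}$ with gadget edges $(a_{x,\ell},b_{x,\ell}),(a_{x,\ell},b'_{x,\ell}),(a'_{x,\ell},b_{x,\ell}),(a'_{x,\ell},b'_{x,\ell})$. For each variable $r$, nodes $c_r,c'_r,d_r,d'_r$ with gadget edges $(c_r,d_r),(c_r,d'_r),(c'_r,d_r),(c'_r,d'_r)$.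 For a positive clause $C_\ell$ with variables in a fixed cyclic order $v_1,\ldots,v_k$ ($k\in\{2,3\}$, indices mod $k$), add edges $(a_{v_j,\ell},b_{v_{j-1},\ell})$. For a negative clause $\neg x\vee\neg y$, add edges $(c_x,d_y),(c_y,d_x)$. For each occurrence of $x$ in a positive clause $C_\ell$, add consistency edges $(a_{x,\ell},d'_x)$ and $(c_x,b'_{x,\ell})$. Preferences (most preferred first): $a_{v_j,\ell}$: $b_{v_{j-1},\ell}\succ b_{v_j,\ell}\succ d'_{v_j}\succ b'_{v_j,\ell}$; $a'_{v_j,\ell}$: $b_{v_j,\ell}\succ b'_{v_j,\ell}$; $b_{v_j,\ell}$: $a_{v_{j+1},\ell}\succ a_{v_j,\ell}\succ a'_{v_j,\ell}$; $b'_{v_j,\ell}$: $a'_{v_j,\ell}\succ c_{v_j}\succ a_{v_j,\ell}$. For the negative clause $\neg x\vee\neg y$ (and symmetrically with $x,y$ swapped): $c_x$: $d_y\succ d_x\succ$ (all $b'_{x,\ell}$ over positive occurrences of $x$, in any order) $\succ d'_x$; $c'_x$: $d_x\succ d'_x$; $d_x$: $c_y\succ c_x\succ c'_x$; $d'_x$: $c'_x\succ$ (all $a_{x,\ell}$, in any order) $\succ c_x$. Edge costs: $0$ for the four gadget edges of each $\{a_{x,\ell},a'_{x,\ell},b_{x,\ell},b'_{x,\ell}\}$ and each $\{c_r,c'_r,d_r,d'_r\}$; $1$ for all other edges. -}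

module Defs where

open import Data.Nat using (ℕ; zero; suc; _<_)
open import Data.Fin using (Fin; zero; suc; toℕ; fromℕ; inject₁)
import Data.Fin as F
import Data.Nat as N
open import Data.Sum using (_⊎_; inj₁; inj₂; swap)
open import Data.Sum.Properties using (≡-dec)
open import Data.Product using (Σ; ∃; _×_; _,_)
open import Data.Bool using (if_then_else_)
open import Relation.Nullary using (¬_; ⌊_⌋)
open import Relation.Binary.PropositionalEquality using (_≡_)
open import Relation.Binary.Definitions using (DecidableEquality)

data Lit (n : ℕ) : Set where
  pos : Fin n → Lit n
  neg : Fin n → Lit n

litVar : ∀ {n} → Lit n → Fin n
litVar (pos i) = i
litVar (neg i) = i

CNF3 : ℕ → ℕ → Set
CNF3 n m = Fin m → Fin 3 → Lit n

DistinctVars : ∀ {n m} → CNF3 n m → Set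
DistinctVars {n} {m} ψ₀ = ∀ (ℓ : Fin m) (j j' : Fin 3) →
  litVar (ψ₀ ℓ j) ≡ litVar (ψ₀ ℓ j') → j ≡ j'

-- The formula ψ.  Variables X₁..X₂ₙ:  inj₁ i stands for X_i, inj₂ i for X_{n+i}.

Var : ℕ → Set
Var n = Fin n ⊎ Fin n

_≟V_ : ∀ {n} → DecidableEquality (Var n)
_≟V_ = ≡-dec F._≟_ F._≟_

-- The other variable of the negative clause (¬X_i ∨ ¬X_{n+i}) containing x.
partner : ∀ {n} → Var n → Var n
partner = swap

-- Positive clauses of ψ: the m (transformed) clauses of ψ₀ (3 literals)
-- and the n clauses (X_i ∨ X_{n+i}) (2 literals).
PC : ℕ → ℕ → Set
PC n m = Fin m ⊎ Fin n

arity : ∀ {n m} → PC n m → ℕ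
arity (inj₁ _) = 3
arity (inj₂ _) = 2

litToVar : ∀ {n} → Lit n → Var n
litToVar (pos i) = inj₁ i
litToVar (neg i) = inj₂ i    -- ¬X_i replaced by X_{n+i}

-- the variable at position j of the positive clause ℓ
-- (positions 0..k-1 give the fixed cyclic order v₁..v_k)
vars : ∀ {n m} → CNF3 n m → (ℓ : PC n m) → Fin (arity ℓ) → Var n
vars ψ₀ (inj₁ ℓ) j = litToVar (ψ₀ ℓ j)
vars ψ₀ (inj₂ i) zero = inj₁ i
vars ψ₀ (inj₂ i) (suc zero) = inj₂ i

prevF : ∀ {k} → Fin k → Fin k
prevF {suc k} zero = fromℕ k
prevF {suc k} (suc i) = inject₁ i

-- The graph G_ψ.  Nodes a,a',b,b' are indexed by a positive clause ℓ and a
-- position j in it (i.e. by the occurrence (v_j, ℓ)); c,c',d,d' by a variable.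

data Node (n m : ℕ) : Set where
  a a' b b' : (ℓ : PC n m) → Fin (arity ℓ) → Node n m
  c c' d d' : Var n → Node n m

data Edge {n m : ℕ} (ψ₀ : CNF3 n m) : Node n m → Node n m → Set where
  gab   : ∀ ℓ j → Edge ψ₀ (a ℓ j) (b ℓ j)
  gab'  : ∀ ℓ j → Edge ψ₀ (a ℓ j) (b' ℓ j)
  ga'b  : ∀ ℓ j → Edge ψ₀ (a' ℓ j) (b ℓ j)
  ga'b' : ∀ ℓ j → Edge ψ₀ (a' ℓ j) (b' ℓ j)
  gcd   : ∀ x → Edge ψ₀ (c x) (d x)
  gcd'  : ∀ x → Edge ψ₀ (c x) (d' x)
  gc'd  : ∀ x → Edge ψ₀ (c' x) (d x)
  gc'd' : ∀ x → Edge ψ₀ (c' x) (d' x)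
  cyc   : ∀ ℓ j → Edge ψ₀ (a ℓ j) (b ℓ (prevF j))
  negE  : ∀ x → Edge ψ₀ (c x) (d (partner x))
  consA : ∀ ℓ j → Edge ψ₀ (a ℓ j) (d' (vars ψ₀ ℓ j))
  consC : ∀ ℓ j → Edge ψ₀ (c (vars ψ₀ ℓ j)) (b' ℓ j)

-- Preferences.  rank τ u v = (tier, tiebreak); smaller is better, compared
-- lexicographically.  Only meaningful when u and v are adjacent.  The
-- tiebreak τ (an injective function) fixes the arbitrary ("in any order")
-- order among the b'_{x,ℓ} in c_x's list and among the a_{x,ℓ} in d'_x's list.

Rank : Set
Rank = ℕ × ℕ

eqN : ℕ → ℕ → Data.Bool.Bool
eqN p q = ⌊ p N.≟ q ⌋
  where import Data.Bool

rank : ∀ {n m} → (Node n m → ℕ) → Node n m → Node n m → Rank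
-- a_{v_j,ℓ}: b_{v_{j-1},ℓ} ≻ b_{v_j,ℓ} ≻ d'_{v_j} ≻ b'_{v_j,ℓ}
rank τ (a ℓ j) (b ℓ' j') = (if eqN (toℕ j') (toℕ (prevF j)) then 0 else 1) , 0
rank τ (a ℓ j) (d' _) = 2 , 0
rank τ (a ℓ j) (b' _ _) = 3 , 0
rank τ (a' ℓ j) (b _ _) = 0 , 0
rank τ (a' ℓ j) (b' _ _) = 1 , 0
-- b_{v_j,ℓ}: a_{v_{j+1},ℓ} ≻ a_{v_j,ℓ} ≻ a'_{v_j,ℓ}
rank τ (b ℓ j) (a ℓ' j') = (if eqN (toℕ (prevF j')) (toℕ j) then 0 else 1) , 0
rank τ (b ℓ j) (a' _ _) = 2 , 0
rank τ (b' ℓ j) (a' _ _) = 0 , 0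
rank τ (b' ℓ j) (c _) = 1 , 0
rank τ (b' ℓ j) (a _ _) = 2 , 0
-- c_x: d_y ≻ d_x ≻ (all b'_{x,ℓ}, in the order given by τ) ≻ d'_x
rank τ (c x) (d y) = (if ⌊ y ≟V x ⌋ then 1 else 0) , 0
rank τ (c x) (b' ℓ j) = 2 , τ (b' ℓ j)
rank τ (c x) (d' _) = 3 , 0
rank τ (c' x) (d _) = 0 , 0
rank τ (c' x) (d' _) = 1 , 0
-- d_x: c_y ≻ c_x ≻ c'_x
rank τ (d x) (c y) = (if ⌊ y ≟V x ⌋ then 1 else 0) , 0
rank τ (d x) (c' _) = 2 , 0
-- d'_x: c'_x ≻ (all a_{x,ℓ}, in the order given by τ) ≻ c_x
rank τ (d' x) (c' _) = 0 , 0
rank τ (d' x) (a ℓ j) = 1 , τ (a ℓ j)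
rank τ (d' x) (c _) = 2 , 0
rank τ _ _ = 0 , 0

_<Lex_ : Rank → Rank → Set
(p , q) <Lex (p' , q') = (p < p') ⊎ (p ≡ p' × q < q')

Prefers : ∀ {n m} → (Node n m → ℕ) → Node n m → Node n m → Node n m → Set
Prefers τ u v w = rank τ u v <Lex rank τ u w

record IsMatching {n m} (ψ₀ : CNF3 n m) (M : Node n m → Node n m → Set) : Set where
  field
    isEdge : ∀ {u v} → M u v → Edge ψ₀ u v
    uniqˡ  : ∀ {u v w} → M u v → M u w → v ≡ w
    uniqʳ  : ∀ {u v w} → M u w → M v w → u ≡ v

Mate : ∀ {n m} → (Node n m → Node n m → Set) → Node n m → Node n m → Set
Mate M u v = M u v ⊎ M v u

Matched : ∀ {n m} → (Node n m → Node n m → Set) → Node n m → Set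
Matched M u = ∃ λ v → Mate M u v

PrefersMatching : ∀ {n m} → (Node n m → ℕ) → Node n m →
  (M N : Node n m → Node n m → Set) → Set
PrefersMatching τ u M N =
  (Matched M u × ¬ Matched N u)
  ⊎ (∃ λ v → ∃ λ w → Mate M u v × Mate N u w × Prefers τ u v w)

-- φ(N,M) > 0 and φ(M,N) = 0, unfolded: some node prefers N to M and none prefers M to N
ParetoOptimal : ∀ {n m} → CNF3 n m → (Node n m → ℕ) →
  (Node n m → Node n m → Set) → Set₁
ParetoOptimal ψ₀ τ M =
  ¬ (Σ (Node _ _ → Node _ _ → Set) λ N →
       IsMatching ψ₀ N
       × (∃ λ u → PrefersMatching τ u N M)
       × (∀ u → ¬ PrefersMatching τ u M N))

-- Swapping the two edges (a_{r,ℓ}, b'_{r,ℓ}) and (c_r, d'_r) for the two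
-- consistency edges (a_{r,ℓ}, d'_r) and (c_r, b'_{r,ℓ}) gives each of the four
-- endpoints a strictly better partner and leaves every other node untouched,
-- so a matching containing both edges is Pareto-dominated.
module Submission where

open import Defs
open import Data.Nat using (ℕ)
open import Data.Nat.Properties using (<-irrefl; <-asym; n<1+n)
open import Data.Fin using (Fin)
open import Data.Bool using (Bool; true; false)
open import Data.Empty using (⊥-elim)
open import Data.Sum using (inj₁; inj₂)
open import Data.Product using (_×_; _,_; proj₁; proj₂)
open import Relation.Nullary using (¬_; yes; no)
open import Relation.Nullary.Decidable.Core using (¬¬-excluded-middle)
open import Relation.Binary.PropositionalEquality using (_≡_; _≢_; refl; sym; trans; subst)
open import Function.Definitions using (Injective)

private
  variable
    n m : ℕ
    ψ₀ : CNF3 n m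
    u v w : Node n m

<Lex-asym : ∀ {r s} → r <Lex s → ¬ s <Lex r
<Lex-asym (inj₁ p) (inj₁ q) = <-asym p q
<Lex-asym (inj₁ p) (inj₂ (refl , _)) = <-irrefl refl p
<Lex-asym (inj₂ (refl , _)) (inj₁ q) = <-irrefl refl q
<Lex-asym (inj₂ (_ , p)) (inj₂ (refl , q)) = <-asym p q

<Lex-irrefl : ∀ {r} → ¬ r <Lex r
<Lex-irrefl p = <Lex-asym p p

isLeft : Node n m → Bool
isLeft (a _ _) = true
isLeft (a' _ _) = true
isLeft (c _) = true
isLeft (c' _) = true
isLeft _ = false

Edge-sides : Edge ψ₀ u v → isLeft u ≡ true × isLeft v ≡ false
Edge-sides (gab _ _) = refl , refl
Edge-sides (gab' _ _) = refl , refl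
Edge-sides (ga'b _ _) = refl , refl
Edge-sides (ga'b' _ _) = refl , refl
Edge-sides (gcd _) = refl , refl
Edge-sides (gcd' _) = refl , refl
Edge-sides (gc'd _) = refl , refl
Edge-sides (gc'd' _) = refl , refl
Edge-sides (cyc _ _) = refl , refl
Edge-sides (negE _) = refl , refl
Edge-sides (consA _ _) = refl , refl
Edge-sides (consC _ _) = refl , refl

Edge-bipartite : Edge ψ₀ u v → ¬ Edge ψ₀ w u
Edge-bipartite e f with () ← trans (sym (proj₁ (Edge-sides e))) (proj₂ (Edge-sides f))

Mate-unique : ∀ {M} → IsMatching ψ₀ M → Mate M u v → Mate M u w → v ≡ w
Mate-unique isM (inj₁ p) (inj₁ q) = IsMatching.uniqˡ isM p q
Mate-unique isM (inj₂ p) (inj₂ q) = IsMatching.uniqʳ isM p q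
Mate-unique isM (inj₁ p) (inj₂ q) = ⊥-elim (Edge-bipartite (isEdge p) (isEdge q))
  where open IsMatching isM
Mate-unique isM (inj₂ p) (inj₁ q) = ⊥-elim (Edge-bipartite (isEdge q) (isEdge p))
  where open IsMatching isM

module Swap {τ : Node n m → ℕ} {M : Node n m → Node n m → Set}
  (isM : IsMatching ψ₀ M) {u₁ v₁ u₂ v₂ : Node n m}
  (e₁ : M u₁ v₁) (e₂ : M u₂ v₂) (f₁ : Edge ψ₀ u₁ v₂) (f₂ : Edge ψ₀ u₂ v₁) where

  open IsMatching isM

  data Swapped : Node n m → Node n m → Set where
    kept : M u v → u ≢ u₁ → u ≢ u₂ → Swapped u v
    new₁ : Swapped u₁ v₂
    new₂ : Swapped u₂ v₁

  Swapped-isMatching : IsMatching ψ₀ Swapped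
  Swapped-isMatching = record { isEdge = edge ; uniqˡ = uniqueˡ ; uniqʳ = uniqueʳ }
    where
    edge : Swapped u v → Edge ψ₀ u v
    edge (kept p _ _) = isEdge p
    edge new₁ = f₁
    edge new₂ = f₂

    uniqueˡ : Swapped u v → Swapped u w → v ≡ w
    uniqueˡ (kept p _ _) (kept q _ _) = uniqˡ p q
    uniqueˡ (kept _ u≢u₁ _) new₁ with () ← u≢u₁ refl
    uniqueˡ (kept _ _ u≢u₂) new₂ with () ← u≢u₂ refl
    uniqueˡ new₁ (kept _ u≢u₁ _) with () ← u≢u₁ refl
    uniqueˡ new₂ (kept _ _ u≢u₂) with () ← u≢u₂ refl
    uniqueˡ new₁ new₁ = refl
    uniqueˡ new₂ new₂ = refl
    uniqueˡ new₁ new₂ = uniqˡ e₂ e₁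
    uniqueˡ new₂ new₁ = uniqˡ e₁ e₂

    uniqueʳ : Swapped u w → Swapped v w → u ≡ v
    uniqueʳ (kept p _ _) (kept q _ _) = uniqʳ p q
    uniqueʳ (kept p _ u≢u₂) new₁ with () ← u≢u₂ (uniqʳ p e₂)
    uniqueʳ (kept p u≢u₁ _) new₂ with () ← u≢u₁ (uniqʳ p e₁)
    uniqueʳ new₁ (kept q _ v≢u₂) with () ← v≢u₂ (uniqʳ q e₂)
    uniqueʳ new₂ (kept q v≢u₁ _) with () ← v≢u₁ (uniqʳ q e₁)
    uniqueʳ new₁ new₁ = refl
    uniqueʳ new₂ new₂ = refl
    uniqueʳ new₁ new₂ = uniqʳ e₁ e₂
    uniqueʳ new₂ new₁ = uniqʳ e₂ e₁

  -- Membership of u in {u₁, u₂} need not be decidable; since the goal is ⊥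
  -- we may still split on it.
  Matched-kept : Matched M u → ¬ ¬ Matched Swapped u
  Matched-kept {u = u} (v , inj₁ p) unmatched = ¬¬-excluded-middle {A = u ≡ u₁} λ where
    (yes refl) → unmatched (v₂ , inj₁ new₁)
    (no u≢u₁) → ¬¬-excluded-middle {A = u ≡ u₂} λ where
      (yes refl) → unmatched (v₁ , inj₁ new₂)
      (no u≢u₂) → unmatched (v , inj₁ (kept p u≢u₁ u≢u₂))
  Matched-kept {u = u} (v , inj₂ p) unmatched = ¬¬-excluded-middle {A = v ≡ u₁} λ where
    (yes refl) → unmatched (u₂ , inj₂ (subst (Swapped u₂) (uniqˡ e₁ p) new₂))
    (no v≢u₁) → ¬¬-excluded-middle {A = v ≡ u₂} λ where
      (yes refl) → unmatched (u₁ , inj₂ (subst (Swapped u₁) (uniqˡ e₂ p) new₁))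
      (no v≢u₂) → unmatched (v , inj₂ (kept p v≢u₁ v≢u₂))

  module _ (better₁ : Prefers τ u₁ v₂ v₁) (better₂ : Prefers τ u₂ v₁ v₂)
           (better₃ : Prefers τ v₁ u₂ u₁) (better₄ : Prefers τ v₂ u₁ u₂) where

    nobody-prefers-M : ∀ u → ¬ PrefersMatching τ u M Swapped
    nobody-prefers-M u (inj₁ (matched , unmatched)) = Matched-kept matched unmatched
    nobody-prefers-M u (inj₂ (v , w , mate , inj₁ (kept q _ _) , pr))
      with refl ← Mate-unique isM mate (inj₁ q) = <Lex-irrefl pr
    nobody-prefers-M u (inj₂ (v , w , mate , inj₂ (kept q _ _) , pr))
      with refl ← Mate-unique isM mate (inj₂ q) = <Lex-irrefl pr
    nobody-prefers-M u (inj₂ (v , w , mate , inj₁ new₁ , pr))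
      with refl ← Mate-unique isM mate (inj₁ e₁) = <Lex-asym better₁ pr
    nobody-prefers-M u (inj₂ (v , w , mate , inj₁ new₂ , pr))
      with refl ← Mate-unique isM mate (inj₁ e₂) = <Lex-asym better₂ pr
    nobody-prefers-M u (inj₂ (v , w , mate , inj₂ new₂ , pr))
      with refl ← Mate-unique isM mate (inj₂ e₁) = <Lex-asym better₃ pr
    nobody-prefers-M u (inj₂ (v , w , mate , inj₂ new₁ , pr))
      with refl ← Mate-unique isM mate (inj₂ e₂) = <Lex-asym better₄ pr

    improving-swap⇒¬ParetoOptimal : ¬ ParetoOptimal ψ₀ τ M
    improving-swap⇒¬ParetoOptimal optimal =
      optimal ( Swapped , Swapped-isMatching
              , (u₁ , inj₂ (v₂ , v₁ , inj₁ new₁ , inj₁ e₁ , better₁))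
              , nobody-prefers-M )

lemma2 : ∀ {n m : ℕ} (ψ₀ : CNF3 n m) → DistinctVars ψ₀ →
    (τ : Node n m → ℕ) → Injective _≡_ _≡_ τ →
    (M : Node n m → Node n m → Set) → IsMatching ψ₀ M → ParetoOptimal ψ₀ τ M →
    ∀ (ℓ : PC n m) (j : Fin (arity ℓ)) →
    ¬ (M (a ℓ j) (b' ℓ j) × M (c (vars ψ₀ ℓ j)) (d' (vars ψ₀ ℓ j)))
lemma2 ψ₀ _ τ _ M isM optimal ℓ j (ab' , cd') =
  -- preference tiers: a: d' 2 < b' 3,  c: b' 2 < d' 3,  b': c 1 < a 2,  d': a 1 < c 2
  Swap.improving-swap⇒¬ParetoOptimal {τ = τ} isM ab' cd' (consA ℓ j) (consC ℓ j)
    (inj₁ (n<1+n 2)) (inj₁ (n<1+n 2)) (inj₁ (n<1+n 1)) (inj₁ (n<1+n 1)) optimal
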